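{- Let $E$ be a finite set and $\tau:2^{E}\to2^{E}$ an operator satisfying (C1) $X\subseteq\tau(X)$ for all $X\subseteq E$, and (C22) for all $F\subseteq G\subseteq E$ with $G\subseteq\tau(F)$, $\tau(G)=\tau(F)$ (a violator space). Let $X\subseteq E$ and $x\in X$. Then $x\notin\tau(X\setminus\{x\})$ (i.e. $x$ is an extreme point of $X$) if and only if $x\in B$ for every set $B\subseteq X$ with $\tau(B)=\tau(X)$. -}

module Defs where

open import Data.Nat using (ℕ)
open import Data.Fin using (Fin)
open import Data.Fin.Subset using (Subset; _⊆_; _∈_)
open import Relation.Binary.PropositionalEquality using (_≡_)
open import Data.Product using (_×_)

C1 : {n : ℕ} → (Subset n → Subset n) → Set
C1 {n} τ = ∀ (X : Subset n) → X ⊆ τ X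

C22 : {n : ℕ} → (Subset n → Subset n) → Set
C22 {n} τ = ∀ (F G : Subset n) → F ⊆ G → G ⊆ τ F → τ G ≡ τ F

IsViolatorSpace : {n : ℕ} → (Subset n → Subset n) → Set
IsViolatorSpace τ = C1 τ × C22 τ

module Submission where

open import Defs
open import Data.Nat using (ℕ)
open import Data.Fin using (Fin; _≟_)
open import Data.Fin.Subset using (Subset; _⊆_; _∈_; _∉_; _-_; _─_; ⁅_⁆; inside; outside)
open import Data.Fin.Subset.Properties using (_∈?_; x∈⁅x⁆; p─q⊆p; x∈p∧x≢y⇒x∈p-y; ⊆-trans)
open import Data.Vec.Base using (_∷_; here; there)
open import Data.Product using (_,_)
open import Relation.Nullary.Decidable using (yes; no; decidable-stable)
open import Relation.Binary.PropositionalEquality using (_≡_; refl; sym; trans; subst)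
open import Function.Bundles using (_⇔_; mk⇔)

-- If x ∉ τ(X - x), any B ⊆ X avoiding x lies in X - x, and since τ B = τ X the
-- sandwich B ⊆ X - x ⊆ X forces τ(X - x) = τ X ∋ x, a contradiction.  Conversely
-- if x ∈ τ(X - x) then X ⊆ τ(X - x), so τ X = τ(X - x) and B = X - x misses x.

x∈p─q⇒x∉q : ∀ {n} (p q : Subset n) {x : Fin n} → x ∈ p ─ q → x ∉ q
x∈p─q⇒x∉q (inside ∷ p) (outside ∷ q) here ()
x∈p─q⇒x∉q (_ ∷ p)      (_ ∷ q)       (there x∈p─q) (there x∈q) = x∈p─q⇒x∉q p q x∈p─q x∈q

x∉p-x : ∀ {n} (p : Subset n) (x : Fin n) → x ∉ p - x
x∉p-x p x x∈p-x = x∈p─q⇒x∉q p ⁅ x ⁆ x∈p-x (x∈⁅x⁆ x)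

p-x⊆p : ∀ {n} (p : Subset n) (x : Fin n) → p - x ⊆ p
p-x⊆p p x = p─q⊆p p ⁅ x ⁆

p⊆q∧x∉p⇒p⊆q-x : ∀ {n} {p q : Subset n} {x : Fin n} → p ⊆ q → x ∉ p → p ⊆ q - x
p⊆q∧x∉p⇒p⊆q-x p⊆q x∉p {y} y∈p = x∈p∧x≢y⇒x∈p-y (p⊆q y∈p) λ { refl → x∉p y∈p }

p-x⊆q∧x∈q⇒p⊆q : ∀ {n} {p q : Subset n} {x : Fin n} → p - x ⊆ q → x ∈ q → p ⊆ q
p-x⊆q∧x∈q⇒p⊆q {x = x} p-x⊆q x∈q {y} y∈p with y ≟ x
... | yes refl = x∈q
... | no y≢x = p-x⊆q (x∈p∧x≢y⇒x∈p-y y∈p y≢x)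

module ViolatorSpace {n : ℕ} (τ : Subset n → Subset n) (c1 : C1 τ) (c22 : C22 τ) where

  τ-sandwich : ∀ {B G X} → B ⊆ G → G ⊆ X → τ B ≡ τ X → τ G ≡ τ X
  τ-sandwich {B} {G} {X} B⊆G G⊆X τB≡τX =
    trans (c22 B G B⊆G (subst (G ⊆_) (sym τB≡τX) (⊆-trans G⊆X (c1 X)))) τB≡τX

  τ-remove-nonextreme : ∀ {X x} → x ∈ τ (X - x) → τ X ≡ τ (X - x)
  τ-remove-nonextreme {X} {x} x∈τ =
    c22 (X - x) X (p-x⊆p X x) (p-x⊆q∧x∈q⇒p⊆q (c1 (X - x)) x∈τ)

  extreme⇒∈basis : ∀ {X x} → x ∈ X → x ∉ τ (X - x) →
                   ∀ B → B ⊆ X → τ B ≡ τ X → x ∈ B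
  extreme⇒∈basis {X} {x} x∈X x∉τ B B⊆X τB≡τX = decidable-stable (x ∈? B) λ x∉B →
    x∉τ (subst (x ∈_) (sym (τ-sandwich (p⊆q∧x∉p⇒p⊆q-x B⊆X x∉B) (p-x⊆p X x) τB≡τX)) (c1 X x∈X))

  ∈basis⇒extreme : ∀ {X x} → (∀ B → B ⊆ X → τ B ≡ τ X → x ∈ B) → x ∉ τ (X - x)
  ∈basis⇒extreme {X} {x} x∈bases x∈τ =
    x∉p-x X x (x∈bases (X - x) (p-x⊆p X x) (sym (τ-remove-nonextreme x∈τ)))

mainTheorem14 : (n : ℕ) → (τ : Subset n → Subset n) → IsViolatorSpace τ →
    (X : Subset n) → (x : Fin n) → x ∈ X →
    ((x ∉ τ (X - x)) ⇔ (∀ (B : Subset n) → B ⊆ X → τ B ≡ τ X → x ∈ B))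
mainTheorem14 n τ (c1 , c22) X x x∈X = mk⇔ (extreme⇒∈basis x∈X) ∈basis⇒extreme
  where open ViolatorSpace τ c1 c22
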